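{- Let $k\geq 2$. If $c=A_a(k,b)\cdot m+n$ is the $k$-normal form of $c$ (i.e. $c=_{\rm NF}A_a(k,b)\cdot m+n$), then $c[k\leftarrow k+1]=A_a(k+1,b[k\leftarrow k+1])\cdot m+n[k\leftarrow k+1]$ is in $(k+1)$-normal form, i.e. $c[k\leftarrow k+1]=_{\rm NF}A_a(k+1,b[k\leftarrow k+1])\cdot m+n[k\leftarrow k+1]$ with respect to base $k+1$.
   Context: For $a,b\in\mathbb N$ and $k\geq2$ define $A_a(k,b)$ by: $A_0(k,b)=k^b$; $A_{a+1}(k,0)=A_a^k(k,\cdot)(0)$; $A_{a+1}(k,b+1)=A_a^k(k,\cdot)(A_{a+1}(k,b))$, where $A_a^k(k,\cdot)$ denotes the $k$-fold composition of $x\mapsto A_a(k,x)$. For every $c>0$ there are unique $a,b,m,n\in\mathbb N$ such that $c=A_a(k,b)\cdot m+n$, $A_a(k,0)\leq c<A_{a+1}(k,0)$, $A_a(k,b)\leq c<A_a(k,b+1)$ and $n<A_a(k,b)$; this is the $k$-normal form of $c$, written $c=_{\rm NF}A_a(k,b)\cdot m+n$ (and analogously for base $k+1$). The base change is defined recursively by $0[k\leftarrow k+1]=0$ and, if $c=_{\rm NF}A_a(k,b)\cdot m+n$, $c[k\leftarrow k+1]=A_a(k+1,b[k\leftarrow k+1])\cdot m+n[k\leftarrow k+1]$. -}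

module Defs where

open import Data.Nat using (ℕ; zero; suc; _+_; _*_; _^_; _≤_; _<_; _≡ᵇ_; _<ᵇ_; _≤ᵇ_)
open import Data.Bool using (Bool; _∧_)
open import Data.Maybe using (Maybe; just; nothing)
open import Data.List using (List; []; _∷_; upTo; concatMap; filterᵇ; head)
open import Data.Product using (_×_; _,_)
open import Relation.Binary.PropositionalEquality using (_≡_)

_^[_]_ : (ℕ → ℕ) → ℕ → ℕ → ℕ
f ^[ zero ] x = x
f ^[ suc i ] x = f (f ^[ i ] x)

A : ℕ → ℕ → ℕ → ℕ
A zero    k b       = k ^ b
A (suc a) k zero    = (A a k) ^[ k ] 0
A (suc a) k (suc b) = (A a k) ^[ k ] (A (suc a) k b)

IsNF : ℕ → ℕ → ℕ → ℕ → ℕ → ℕ → Set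
IsNF k c a b m n =
  (c ≡ A a k b * m + n) ×
  (A a k 0 ≤ c) × (c < A (suc a) k 0) ×
  (A a k b ≤ c) × (c < A a k (suc b)) ×
  (n < A a k b)

isNFᵇ : ℕ → ℕ → ℕ → ℕ → ℕ → ℕ → Bool
isNFᵇ k c a b m n =
  (c ≡ᵇ A a k b * m + n) ∧
  (A a k 0 ≤ᵇ c) ∧ (c <ᵇ A (suc a) k 0) ∧
  (A a k b ≤ᵇ c) ∧ (c <ᵇ A a k (suc b)) ∧
  (n <ᵇ A a k b)

-- all quadruples (a,b,m,n) with entries ≤ c  (the normal form of c > 0 has all entries ≤ c)
quads : ℕ → List (ℕ × ℕ × ℕ × ℕ)
quads c =
  concatMap (λ a → concatMap (λ b → concatMap (λ m → concatMap (λ n →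
    (a , b , m , n) ∷ []) (upTo (suc c))) (upTo (suc c))) (upTo (suc c))) (upTo (suc c))

nf : ℕ → ℕ → Maybe (ℕ × ℕ × ℕ × ℕ)
nf k c = head (filterᵇ (λ { (a , b , m , n) → isNFᵇ k c a b m n }) (quads c))

-- base change with fuel; the recursive calls are on b, n < c, so fuel c+1 suffices
bcFuel : ℕ → ℕ → ℕ → ℕ
bcFuel k zero    c = 0
bcFuel k (suc f) c with nf k c
... | nothing              = 0
... | just (a , b , m , n) = A a (suc k) (bcFuel k f b) * m + bcFuel k f n

_[_←+1] : ℕ → ℕ → ℕ
c [ k ←+1] = bcFuel k (suc c) c

-- Write B c for c [ k ←+1]. Unfolding the search in nf shows B c = A_a(k+1, B b)·m + B n
-- whenever c = A_a(k,b)·m + n is in k-normal form, so only the five bounds of the normal form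
-- remain. They follow once B is known to be strictly increasing (hence B x ≥ x): the remainder
-- satisfies B n < B (A_a(k,b)) = A_a(k+1, B b), and the coefficient still fits because
-- x ↦ A_a(k,x) at least doubles at every step, which gives A_a(k+1,b′)·(m+1) ≤ A_a(k+1,b′+1)
-- for all b′ ≥ b. Strict monotonicity of B is proved by induction, comparing the normal forms
-- of c < d lexicographically and using these very bounds for smaller arguments.
module Submission where

open import Defs
open import Data.Nat.Base
open import Data.Nat.Properties
open import Data.Nat.DivMod
open import Data.Bool.Base using (Bool; true; false; T)
open import Data.Bool.Properties using (T-∧)
open import Data.Product using (_×_; _,_; ∃-syntax)
open import Data.Sum using (inj₁; inj₂)
open import Data.Empty using (⊥-elim)
open import Data.Maybe using (just; nothing)
open import Data.List using (List; []; _∷_; upTo; concatMap; filterᵇ; head)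
open import Data.List.Relation.Unary.Any using (here; there)
open import Data.List.Membership.Propositional using (_∈_; lose)
open import Data.List.Membership.Propositional.Properties using (∈-upTo⁺; ∈-concatMap⁺)
open import Function.Bundles using (Equivalence)
open import Relation.Nullary using (yes; no)
open import Relation.Binary.PropositionalEquality

open Equivalence using (to; from)

variable
  a a′ b b′ c d m m′ n n′ x y : ℕ

module _ {f : ℕ → ℕ} where

  iterate-mono-≤ : (∀ {x y} → x ≤ y → f x ≤ f y) → ∀ i → x ≤ y → f ^[ i ] x ≤ f ^[ i ] y
  iterate-mono-≤ mono zero    x≤y = x≤y
  iterate-mono-≤ mono (suc i) x≤y = mono (iterate-mono-≤ mono i x≤y)

  iterate-mono-< : (∀ {x y} → x < y → f x < f y) → ∀ i → x < y → f ^[ i ] x < f ^[ i ] y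
  iterate-mono-< mono zero    x<y = x<y
  iterate-mono-< mono (suc i) x<y = mono (iterate-mono-< mono i x<y)

  iterate-inflationary : (∀ x → x ≤ f x) → ∀ i x → x ≤ f ^[ i ] x
  iterate-inflationary infl zero    x = ≤-refl
  iterate-inflationary infl (suc i) x = ≤-trans (iterate-inflationary infl i x) (infl _)

iterate-≤-pointwise : ∀ {f g : ℕ → ℕ} → (∀ x → f x ≤ g x) → (∀ {x y} → x ≤ y → g x ≤ g y) →
                      ∀ i x → f ^[ i ] x ≤ g ^[ i ] x
iterate-≤-pointwise f≤g mono zero    x = ≤-refl
iterate-≤-pointwise f≤g mono (suc i) x = ≤-trans (f≤g _) (mono (iterate-≤-pointwise f≤g mono i x))

record Doubling (g : ℕ → ℕ) : Set where
  field
    positive₀    : 0 < g 0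
    doubles-step : ∀ x → 2 * g x ≤ g (suc x)

  ≤-next : ∀ x → g x ≤ g (suc x)
  ≤-next x = ≤-trans (m≤m+n (g x) (g x + 0)) (doubles-step x)

  positive : ∀ x → 0 < g x
  positive zero    = positive₀
  positive (suc x) = ≤-trans (positive x) (≤-next x)

  doubles : x < y → 2 * g x ≤ g y
  doubles {x} {suc y} (s≤s x≤y) with m≤n⇒m<n∨m≡n x≤y
  ... | inj₁ x<y  = ≤-trans (doubles x<y) (≤-next y)
  ... | inj₂ refl = doubles-step x

  mono-< : x < y → g x < g y
  mono-< {x} x<y = <-≤-trans (m<m+n (g x) (≤-trans (positive x) (m≤m+n (g x) 0))) (doubles x<y)

  mono-≤ : x ≤ y → g x ≤ g y
  mono-≤ x≤y with m≤n⇒m<n∨m≡n x≤y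
  ... | inj₁ x<y  = <⇒≤ (mono-< x<y)
  ... | inj₂ refl = ≤-refl

  cancel-< : g x < g y → x < y
  cancel-< {x} {y} gx<gy with x <? y
  ... | yes x<y = x<y
  ... | no  x≮y = ⊥-elim (<⇒≱ gx<gy (mono-≤ (≮⇒≥ x≮y)))

  x<g[x] : ∀ x → x < g x
  x<g[x] zero    = positive₀
  x<g[x] (suc x) = <-≤-trans (s≤s (x<g[x] x)) (mono-< (n<1+n x))

  x≤g[x] : ∀ x → x ≤ g x
  x≤g[x] x = <⇒≤ (x<g[x] x)

  2x≤g[x] : ∀ x → 2 * x ≤ g x
  2x≤g[x] zero    = z≤n
  2x≤g[x] (suc x) = ≤-trans (*-monoʳ-≤ 2 (x<g[x] x)) (doubles-step x)

  bracket-≤ : g x ≤ c → c < g (suc y) → x ≤ y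
  bracket-≤ gx≤c c<gy = ≤-pred (cancel-< (≤-<-trans gx≤c c<gy))

  bracket : g 0 ≤ c → ∃[ x ] g x ≤ c × c < g (suc x)
  bracket {c} g0≤c = search c (x<g[x] c)
    where
    search : ∀ y → c < g y → ∃[ x ] g x ≤ c × c < g (suc x)
    search zero    c<g0 = ⊥-elim (<⇒≱ c<g0 g0≤c)
    search (suc y) c<gy with c <? g y
    ... | yes c<g[y] = search y c<g[y]
    ... | no  c≮g[y] = y , ≮⇒≥ c≮g[y] , c<gy

open Doubling

iterate-doubling : ∀ {g} → Doubling g → ∀ i → Doubling (g ^[ suc i ]_)
iterate-doubling D i = record
  { positive₀    = positive D _
  ; doubles-step = λ x → doubles D (iterate-mono-< (mono-< D) i (n<1+n x))
  }

doubling-beats-linear : ∀ {h} → Doubling h → 0 < y → y ≤ x → y * m < h y → x * m < h x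
doubling-beats-linear {y = y} {x = zero} D 0<y y≤0 _ = ⊥-elim (<⇒≱ 0<y y≤0)
doubling-beats-linear {y = y} {x = suc x} {m = m} {h = h} D 0<y y≤1+x ym<hy with m≤n⇒m<n∨m≡n y≤1+x
... | inj₂ refl = ym<hy
... | inj₁ (s≤s y≤x) = begin-strict
    m + x * m     <⟨ +-mono-< m<hx xm<hx ⟩
    h x + h x     ≡⟨ cong (h x +_) (sym (+-identityʳ (h x))) ⟩
    2 * h x       ≤⟨ doubles-step D x ⟩
    h (suc x)     ∎
  where
  open ≤-Reasoning
  xm<hx : x * m < h x
  xm<hx = doubling-beats-linear D 0<y y≤x ym<hy
  m<hx : m < h x
  m<hx = ≤-<-trans (m≤n*m m x {{>-nonZero (<-≤-trans 0<y y≤x)}}) xm<hx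

A-doubling : ∀ {k} → 2 ≤ k → ∀ a → Doubling (A a k)
A-doubling {k} 2≤k zero = record
  { positive₀    = s≤s z≤n
  ; doubles-step = λ x → *-monoˡ-≤ (k ^ x) 2≤k
  }
A-doubling {suc k} 2≤k@(s≤s _) (suc a) = record
  { positive₀    = positive D _
  ; doubles-step = λ x → ≤-trans (*-monoʳ-≤ 2 (iterate-inflationary (x≤g[x] D) k _)) (2x≤g[x] D _)
  }
  where
  D : Doubling (A a (suc k))
  D = A-doubling 2≤k a

A₀-doubling : ∀ {k} → 2 ≤ k → Doubling (λ a → A a k 0)
A₀-doubling 2≤k@(s≤s (s≤s _)) = record
  { positive₀    = s≤s z≤n
  ; doubles-step = λ a → let D = A-doubling 2≤k a in
                         ≤-trans (2x≤g[x] D _) (mono-≤ D (mono-≤ D z≤n))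
  }

A-base-mono : ∀ {k} → 2 ≤ k → ∀ a b → A a k b ≤ A a (suc k) b
A-base-mono {k} 2≤k zero    b = ^-monoˡ-≤ b (n≤1+n k)
A-base-mono {k} 2≤k (suc a) b = go b
  where
  D′ : Doubling (A a (suc k))
  D′ = A-doubling (m≤n⇒m≤1+n 2≤k) a
  iterate-≤ : x ≤ y → A a k ^[ k ] x ≤ A a (suc k) ^[ suc k ] y
  iterate-≤ x≤y = ≤-trans (iterate-≤-pointwise (A-base-mono 2≤k a) (mono-≤ D′) k _)
                 (≤-trans (iterate-mono-≤ (mono-≤ D′) k x≤y) (x≤g[x] D′ _))
  go : ∀ b → A (suc a) k b ≤ A (suc a) (suc k) b
  go zero    = iterate-≤ ≤-refl
  go (suc b) = iterate-≤ (go b)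

module _ {d : ℕ} where

  euclid-quotient-mono : ∀ {q r q′ r′} → r′ < d → d * q + r ≤ d * q′ + r′ → q ≤ q′
  euclid-quotient-mono {q} {r} {q′} {r′} r′<d le with q ≤? q′
  ... | yes q≤q′ = q≤q′
  ... | no  q≰q′ = ⊥-elim (<⇒≱ d*q′+r′<d*q+r le)
    where
    open ≤-Reasoning
    d*q′+r′<d*q+r : d * q′ + r′ < d * q + r
    d*q′+r′<d*q+r = begin-strict
      d * q′ + r′  <⟨ +-monoʳ-< (d * q′) r′<d ⟩
      d * q′ + d   ≡⟨ +-comm (d * q′) d ⟩
      d + d * q′   ≡⟨ *-suc d q′ ⟨
      d * suc q′   ≤⟨ *-monoʳ-≤ d (≰⇒> q≰q′) ⟩
      d * q        ≤⟨ m≤m+n (d * q) r ⟩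
      d * q + r    ∎

  euclid-unique : ∀ {q r q′ r′} → r < d → r′ < d → d * q + r ≡ d * q′ + r′ → q ≡ q′ × r ≡ r′
  euclid-unique {q} {r} {q′} {r′} r<d r′<d eq =
    q≡q′ , +-cancelˡ-≡ (d * q) r r′ (trans eq (cong (λ q → d * q + r′) (sym q≡q′)))
    where
    q≡q′ : q ≡ q′
    q≡q′ = ≤-antisym (euclid-quotient-mono r′<d (≤-reflexive eq))
                     (euclid-quotient-mono r<d (≤-reflexive (sym eq)))

  euclid-exists : 0 < d → ∀ c → ∃[ q ] ∃[ r ] r < d × c ≡ d * q + r
  euclid-exists 0<d c = c / d , c % d , m%n<n c d , c≡d*[c/d]+c%d
    where
    instance
      d≢0 : NonZero d
      d≢0 = >-nonZero 0<d
    c≡d*[c/d]+c%d : c ≡ d * (c / d) + c % d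
    c≡d*[c/d]+c%d = trans (m≡m%n+[m/n]*n c d)
                          (trans (+-comm (c % d) _) (cong (_+ c % d) (*-comm (c / d) d)))

module _ {A : Set} (p : A → Bool) where

  head-filterᵇ-sound : ∀ xs {x} → head (filterᵇ p xs) ≡ just x → T (p x)
  head-filterᵇ-sound (y ∷ ys) eq with p y in py
  head-filterᵇ-sound (y ∷ ys) refl | true = subst T (sym py) _
  head-filterᵇ-sound (y ∷ ys) eq   | false = head-filterᵇ-sound ys eq

  head-filterᵇ-unique : ∀ {xs x} → x ∈ xs → T (p x) → (∀ y → T (p y) → y ≡ x) →
                        head (filterᵇ p xs) ≡ just x
  head-filterᵇ-unique {y ∷ ys} x∈xs px unique with p y in py
  ... | true = cong just (unique y (subst T (sym py) _))
  head-filterᵇ-unique {y ∷ ys} (here refl) px unique | false = ⊥-elim (subst T py px)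
  head-filterᵇ-unique {y ∷ ys} (there x∈ys) px unique | false = head-filterᵇ-unique x∈ys px unique

-- IsNF k c a b m n unfolds to a product, so its indices cannot be inferred from a proof;
-- NF states the same six conditions as a record, whose indices can.
record NF (k c a b m n : ℕ) : Set where
  constructor mkNF
  field
    c≡    : c ≡ A a k b * m + n
    A₀≤c  : A a k 0 ≤ c
    c<A₁  : c < A (suc a) k 0
    Ab≤c  : A a k b ≤ c
    c<Ab₁ : c < A a k (suc b)
    n<Ab  : n < A a k b

IsNF⇒NF : ∀ {k c a b m n} → IsNF k c a b m n → NF k c a b m n
IsNF⇒NF (c≡ , A₀≤c , c<A₁ , Ab≤c , c<Ab₁ , n<Ab) = mkNF c≡ A₀≤c c<A₁ Ab≤c c<Ab₁ n<Ab

NF⇒IsNF : ∀ {k c a b m n} → NF k c a b m n → IsNF k c a b m n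
NF⇒IsNF (mkNF c≡ A₀≤c c<A₁ Ab≤c c<Ab₁ n<Ab) = c≡ , A₀≤c , c<A₁ , Ab≤c , c<Ab₁ , n<Ab

isNFᵇ-sound : ∀ k c a b m n → T (isNFᵇ k c a b m n) → NF k c a b m n
isNFᵇ-sound k c a b m n t =
  let e , t = to T-∧ t; l₀ , t = to T-∧ t; u₀ , t = to T-∧ t; l , t = to T-∧ t; u , r = to T-∧ t
  in mkNF (≡ᵇ⇒≡ _ _ e) (≤ᵇ⇒≤ _ _ l₀) (<ᵇ⇒< _ _ u₀) (≤ᵇ⇒≤ _ _ l) (<ᵇ⇒< _ _ u) (<ᵇ⇒< _ _ r)

isNFᵇ-complete : ∀ {k} → NF k c a b m n → T (isNFᵇ k c a b m n)
isNFᵇ-complete (mkNF e l₀ u₀ l u r) =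
  from T-∧ (≡⇒≡ᵇ _ _ e , from T-∧ (≤⇒≤ᵇ l₀ , from T-∧ (<⇒<ᵇ u₀ ,
    from T-∧ (≤⇒≤ᵇ l , from T-∧ (<⇒<ᵇ u , <⇒<ᵇ r)))))

∈-concatMap-upTo : ∀ {B : Set} (f : ℕ → List B) {y} → x ≤ c → y ∈ f x →
                   y ∈ concatMap f (upTo (suc c))
∈-concatMap-upTo f x≤c y∈fx = ∈-concatMap⁺ f (lose (∈-upTo⁺ (s≤s x≤c)) y∈fx)

∈-quads : a ≤ c → b ≤ c → m ≤ c → n ≤ c → (a , b , m , n) ∈ quads c
∈-quads {a} {c} {b} {m} {n} a≤c b≤c m≤c n≤c =
  ∈-concatMap-upTo fa a≤c (∈-concatMap-upTo fb b≤c
    (∈-concatMap-upTo fm m≤c (∈-concatMap-upTo fn n≤c (here refl))))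
  where
  U : List ℕ
  U = upTo (suc c)
  -- spelled out because Agda cannot recover them by unifying with the unfolded goal
  fa fb fm fn : ℕ → List (ℕ × ℕ × ℕ × ℕ)
  fn = λ n → (a , b , m , n) ∷ []
  fm = λ m → concatMap (λ n → (a , b , m , n) ∷ []) U
  fb = λ b → concatMap (λ m → concatMap (λ n → (a , b , m , n) ∷ []) U) U
  fa = λ a → concatMap (λ b → concatMap (λ m → concatMap (λ n → (a , b , m , n) ∷ []) U) U) U

nf-sound : ∀ k c → nf k c ≡ just (a , b , m , n) → NF k c a b m n
nf-sound {a} {b} {m} {n} k c eq =
  isNFᵇ-sound k c a b m n (head-filterᵇ-sound (λ (a , b , m , n) → isNFᵇ k c a b m n) (quads c) eq)

module NormalForms (k₀ : ℕ) where

  k : ℕ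
  k = 2 + k₀

  2≤k : 2 ≤ k
  2≤k = s≤s (s≤s z≤n)

  Aᵈ : ∀ a → Doubling (A a k)
  Aᵈ = A-doubling 2≤k

  A′ᵈ : ∀ a → Doubling (A a (suc k))
  A′ᵈ = A-doubling (m≤n⇒m≤1+n 2≤k)

  A₀ᵈ : Doubling (λ a → A a k 0)
  A₀ᵈ = A₀-doubling 2≤k

  A′₀ᵈ : Doubling (λ a → A a (suc k) 0)
  A′₀ᵈ = A₀-doubling (m≤n⇒m≤1+n 2≤k)

  nf-level<c : NF k c a b m n → a < c
  nf-level<c h = <-≤-trans (x<g[x] A₀ᵈ _) (NF.A₀≤c h)

  nf-exponent<c : NF k c a b m n → b < c
  nf-exponent<c {a = a} h = <-≤-trans (x<g[x] (Aᵈ a) _) (NF.Ab≤c h)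

  nf-remainder<c : NF k c a b m n → n < c
  nf-remainder<c h = <-≤-trans (NF.n<Ab h) (NF.Ab≤c h)

  nf-coefficient-positive : NF k c a b m n → 0 < m
  nf-coefficient-positive {a = a} {b} {m} {n} (mkNF refl _ _ Ab≤c _ n<Ab) =
    euclid-quotient-mono n<Ab (subst (_≤ A a k b * m + n) A≡A*1+0 Ab≤c)
    where
    A≡A*1+0 : A a k b ≡ A a k b * 1 + 0
    A≡A*1+0 = sym (trans (+-identityʳ _) (*-identityʳ (A a k b)))

  nf-coefficient≤c : NF k c a b m n → m ≤ c
  nf-coefficient≤c {a = a} {b} {m} (mkNF refl _ _ _ _ _) =
    ≤-trans (m≤n*m m (A a k b) {{>-nonZero (positive (Aᵈ a) b)}}) (m≤m+n _ _)

  nf-level-mono : c ≤ d → NF k c a b m n → NF k d a′ b′ m′ n′ → a ≤ a′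
  nf-level-mono c≤d h h′ = bracket-≤ A₀ᵈ (NF.A₀≤c h) (≤-<-trans c≤d (NF.c<A₁ h′))

  nf-exponent-mono : c ≤ d → NF k c a b m n → NF k d a b′ m′ n′ → b ≤ b′
  nf-exponent-mono {a = a} c≤d h h′ = bracket-≤ (Aᵈ a) (NF.Ab≤c h) (≤-<-trans c≤d (NF.c<Ab₁ h′))

  nf-coefficient-mono : c ≤ d → NF k c a b m n → NF k d a b m′ n′ → m ≤ m′
  nf-coefficient-mono c≤d (mkNF refl _ _ _ _ _) (mkNF refl _ _ _ _ n′<Ab) =
    euclid-quotient-mono n′<Ab c≤d

  NF-unique : NF k c a b m n → NF k c a′ b′ m′ n′ → (a , b , m , n) ≡ (a′ , b′ , m′ , n′)
  NF-unique h h′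
    with refl ← ≤-antisym (nf-level-mono ≤-refl h h′) (nf-level-mono ≤-refl h′ h)
    with refl ← ≤-antisym (nf-exponent-mono ≤-refl h h′) (nf-exponent-mono ≤-refl h′ h)
    with refl , refl ← euclid-unique (NF.n<Ab h) (NF.n<Ab h′) (trans (sym (NF.c≡ h)) (NF.c≡ h′))
    = refl

  NF-exists : 0 < c → ∃[ a ] ∃[ b ] ∃[ m ] ∃[ n ] NF k c a b m n
  NF-exists {c} 0<c with a , A₀≤c , c<A₁ ← bracket A₀ᵈ 0<c
                    with b , Ab≤c , c<Ab₁ ← bracket (Aᵈ a) A₀≤c
                    with m , n , n<Ab , c≡ ← euclid-exists (positive (Aᵈ a) b) c
    = a , b , m , n , mkNF c≡ A₀≤c c<A₁ Ab≤c c<Ab₁ n<Ab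

  nf-complete : NF k c a b m n → nf k c ≡ just (a , b , m , n)
  nf-complete {c} h = head-filterᵇ-unique (λ (a , b , m , n) → isNFᵇ k c a b m n)
    (∈-quads (<⇒≤ (nf-level<c h)) (<⇒≤ (nf-exponent<c h))
             (nf-coefficient≤c h) (<⇒≤ (nf-remainder<c h)))
    (isNFᵇ-complete h)
    (λ (a′ , b′ , m′ , n′) t → NF-unique (isNFᵇ-sound k c a′ b′ m′ n′ t) h)

  bcFuel-irrelevant : ∀ {f f′} c → c < f → c < f′ → bcFuel k f c ≡ bcFuel k f′ c
  bcFuel-irrelevant {suc f} {suc f′} c (s≤s c≤f) (s≤s c≤f′) with nf k c in eq
  ... | nothing = refl
  ... | just (a , b , m , n) =
    cong₂ (λ u v → A a (suc k) u * m + v)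
          (bcFuel-irrelevant b (<-≤-trans b<c c≤f) (<-≤-trans b<c c≤f′))
          (bcFuel-irrelevant n (<-≤-trans n<c c≤f) (<-≤-trans n<c c≤f′))
    where
    b<c : b < c
    b<c = nf-exponent<c (nf-sound k c eq)
    n<c : n < c
    n<c = nf-remainder<c (nf-sound k c eq)

  bcFuel-nf : ∀ f c → nf k c ≡ just (a , b , m , n) →
              bcFuel k (suc f) c ≡ A a (suc k) (bcFuel k f b) * m + bcFuel k f n
  bcFuel-nf f c eq rewrite eq = refl

  [←+1]-nf : NF k c a b m n → c [ k ←+1] ≡ A a (suc k) (b [ k ←+1]) * m + n [ k ←+1]
  [←+1]-nf {c} {a} {b} {m} {n} h = trans (bcFuel-nf c c (nf-complete h))
    (cong₂ (λ u v → A a (suc k) u * m + v)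
           (bcFuel-irrelevant b (nf-exponent<c h) (n<1+n b))
           (bcFuel-irrelevant n (nf-remainder<c h) (n<1+n n)))

  nf-coefficient-fits : NF k c a b m n → b ≤ b′ → A a (suc k) b′ * suc m ≤ A a (suc k) (suc b′)
  nf-coefficient-fits {a = zero} {b} {m} {n} {b′} (mkNF refl _ _ _ c<kᵇ⁺¹ _) _ = begin
      X * suc m      ≤⟨ *-monoʳ-≤ X (s≤s (<⇒≤ m<k)) ⟩
      X * suc k      ≡⟨ *-comm X (suc k) ⟩
      suc k ^ suc b′ ∎
    where
    open ≤-Reasoning
    X : ℕ
    X = suc k ^ b′
    m<k : m < k
    m<k = *-cancelˡ-< (k ^ b) m k
            (<-≤-trans (≤-<-trans (m≤m+n _ n) c<kᵇ⁺¹) (≤-reflexive (*-comm k (k ^ b))))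
  nf-coefficient-fits {a = suc a} {b} {m} {n} {b′} (mkNF refl _ _ _ c<h[Y] _) b≤b′ = begin
      X * suc m                   ≡⟨ *-suc X m ⟩
      X + X * m                   ≤⟨ +-mono-≤ (iterate-inflationary (x≤g[x] (Aᵈ a)) k X) (<⇒≤ Xm<hX) ⟩
      h X + h X                   ≡⟨ cong (h X +_) (+-identityʳ (h X)) ⟨
      2 * h X                     ≤⟨ *-monoʳ-≤ 2 h≤h′ ⟩
      2 * (A a (suc k) ^[ k ] X)  ≤⟨ 2x≤g[x] (A′ᵈ a) _ ⟩
      A (suc a) (suc k) (suc b′)  ∎
    where
    open ≤-Reasoning
    h : ℕ → ℕ
    h = A a k ^[ k ]_
    X Y : ℕ
    X = A (suc a) (suc k) b′
    Y = A (suc a) k b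
    Y≤X : Y ≤ X
    Y≤X = ≤-trans (A-base-mono 2≤k (suc a) b) (mono-≤ (A′ᵈ (suc a)) b≤b′)
    h≤h′ : h X ≤ A a (suc k) ^[ k ] X
    h≤h′ = iterate-≤-pointwise (A-base-mono 2≤k a) (mono-≤ (A′ᵈ a)) k X
    Xm<hX : X * m < h X
    Xm<hX = doubling-beats-linear (iterate-doubling (Aᵈ a) (suc k₀)) (positive (Aᵈ (suc a)) b) Y≤X
              (≤-<-trans (m≤m+n (Y * m) n) c<h[Y])

module BaseChange (k₀ : ℕ) where

  open NormalForms k₀

  B : ℕ → ℕ
  B c = c [ k ←+1]

  StrictMonoBelow : ℕ → Set
  StrictMonoBelow D = ∀ {x y} → x < y → y < D → B x < B y

  restrict : ∀ {D D′} → StrictMonoBelow D → D′ ≤ D → StrictMonoBelow D′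
  restrict mono D′≤D x<y y<D′ = mono x<y (<-≤-trans y<D′ D′≤D)

  B-inflationary : StrictMonoBelow (suc x) → x ≤ B x
  B-inflationary {zero}  mono = z≤n
  B-inflationary {suc x} mono =
    <-≤-trans (s≤s (B-inflationary (restrict mono (n≤1+n _)))) (mono (n<1+n x) ≤-refl)

  B-on-A : ∀ a t → A a k t < A (suc a) k 0 → B (A a k t) ≡ A a (suc k) (B t)
  B-on-A a t A<A₁ = trans ([←+1]-nf A-in-NF) (trans (+-identityʳ _) (*-identityʳ _))
    where
    A-in-NF : NF k (A a k t) a t 1 0
    A-in-NF = mkNF (sym (trans (+-identityʳ _) (*-identityʳ _))) (mono-≤ (Aᵈ a) z≤n) A<A₁ ≤-refl
                   (mono-< (Aᵈ a) (n<1+n t)) (positive (Aᵈ a) t)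

  B-on-iterate : ∀ a j → A a k ^[ j ] 0 < A (suc a) k 0 → B (A a k ^[ j ] 0) ≡ A a (suc k) ^[ j ] 0
  B-on-iterate a zero    _  = refl
  B-on-iterate a (suc j) lt =
    trans (B-on-A a _ lt) (cong (A a (suc k)) (B-on-iterate a j (<-trans (x<g[x] (Aᵈ a) _) lt)))

  B-lower : NF k c a b m n → A a (suc k) (B b) ≤ B c
  B-lower {c} {a} {b} {m} {n} h = begin
      X            ≡⟨ *-identityʳ X ⟨
      X * 1        ≤⟨ *-monoʳ-≤ X (nf-coefficient-positive h) ⟩
      X * m        ≤⟨ m≤m+n (X * m) (B n) ⟩
      X * m + B n  ≡⟨ [←+1]-nf h ⟨
      B c          ∎
    where
    open ≤-Reasoning
    X : ℕ
    X = A a (suc k) (B b)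

  B-remainder< : StrictMonoBelow (suc c) → NF k c a b m n → B n < A a (suc k) (B b)
  B-remainder< {a = a} {b} {n = n} mono (mkNF _ _ c<A₁ Ab≤c _ n<Ab) =
    subst (B n <_) (B-on-A a b (≤-<-trans Ab≤c c<A₁)) (mono n<Ab (s≤s Ab≤c))

  B<A′[Bb]*[1+m] : StrictMonoBelow (suc c) → NF k c a b m n → B c < A a (suc k) (B b) * suc m
  B<A′[Bb]*[1+m] {c} {a} {b} {m} {n} mono h = begin-strict
      B c          ≡⟨ [←+1]-nf h ⟩
      X * m + B n  <⟨ +-monoʳ-< (X * m) (B-remainder< mono h) ⟩
      X * m + X    ≡⟨ +-comm (X * m) X ⟩
      X + X * m    ≡⟨ *-suc X m ⟨
      X * suc m    ∎
    where
    open ≤-Reasoning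
    X : ℕ
    X = A a (suc k) (B b)

  B-upper : StrictMonoBelow (suc c) → NF k c a b m n → B c < A a (suc k) (suc (B b))
  B-upper mono h = <-≤-trans (B<A′[Bb]*[1+m] mono h)
    (nf-coefficient-fits h (B-inflationary (restrict mono (s≤s (<⇒≤ (nf-exponent<c h))))))

  B-level-upper : StrictMonoBelow (A (suc a) k 0) → NF k c a b m n → B c < A (suc a) (suc k) 0
  B-level-upper {a} {c} {b = b} mono h@(mkNF _ _ c<A₁ Ab≤c _ _) = begin-strict
      B c                                      <⟨ B-upper (restrict mono c<A₁) h ⟩
      A a (suc k) (suc (B b))                  ≤⟨ mono-≤ (A′ᵈ a) 1+Bb≤B[T₀] ⟩
      A a (suc k) (A a (suc k) ^[ suc k₀ ] 0)  ≤⟨ x≤g[x] (A′ᵈ a) _ ⟩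
      A (suc a) (suc k) 0                      ∎
    where
    open ≤-Reasoning
    T₀ : ℕ
    T₀ = A a k ^[ suc k₀ ] 0
    T₀<A₁ : T₀ < A (suc a) k 0
    T₀<A₁ = x<g[x] (Aᵈ a) T₀
    b<T₀ : b < T₀
    b<T₀ = cancel-< (Aᵈ a) (≤-<-trans Ab≤c c<A₁)
    1+Bb≤B[T₀] : suc (B b) ≤ A a (suc k) ^[ suc k₀ ] 0
    1+Bb≤B[T₀] = subst (suc (B b) ≤_) (B-on-iterate a (suc k₀) T₀<A₁) (mono b<T₀ T₀<A₁)

  B-<-NF : StrictMonoBelow d → c < d → NF k c a b m n → NF k d a′ b′ m′ n′ → B c < B d
  B-<-NF {d} {c} {a} {b} {m} {n} {a′} {b′} {m′} {n′} mono c<d h h′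
    with m≤n⇒m<n∨m≡n (nf-level-mono (<⇒≤ c<d) h h′)
  ... | inj₁ a<a′ = begin-strict
      B c                  <⟨ B-level-upper (restrict mono (≤-trans (mono-≤ A₀ᵈ a<a′) (NF.A₀≤c h′))) h ⟩
      A (suc a) (suc k) 0  ≤⟨ mono-≤ A′₀ᵈ a<a′ ⟩
      A a′ (suc k) 0       ≤⟨ mono-≤ (A′ᵈ a′) z≤n ⟩
      A a′ (suc k) (B b′)  ≤⟨ B-lower h′ ⟩
      B d                  ∎
    where open ≤-Reasoning
  ... | inj₂ refl with m≤n⇒m<n∨m≡n (nf-exponent-mono (<⇒≤ c<d) h h′)
  ...   | inj₁ b<b′ = begin-strict
      B c                      <⟨ B-upper (restrict mono c<d) h ⟩
      A a (suc k) (suc (B b))  ≤⟨ mono-≤ (A′ᵈ a) (mono b<b′ (nf-exponent<c h′)) ⟩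
      A a (suc k) (B b′)       ≤⟨ B-lower h′ ⟩
      B d                      ∎
    where open ≤-Reasoning
  ...   | inj₂ refl with m≤n⇒m<n∨m≡n (nf-coefficient-mono (<⇒≤ c<d) h h′)
  ...     | inj₁ m<m′ = begin-strict
      B c                            <⟨ B<A′[Bb]*[1+m] (restrict mono c<d) h ⟩
      A a (suc k) (B b) * suc m      ≤⟨ *-monoʳ-≤ (A a (suc k) (B b)) m<m′ ⟩
      A a (suc k) (B b) * m′         ≤⟨ m≤m+n _ (B n′) ⟩
      A a (suc k) (B b) * m′ + B n′  ≡⟨ [←+1]-nf h′ ⟨
      B d                            ∎
    where open ≤-Reasoning
  ...     | inj₂ refl = begin-strict
      B c                           ≡⟨ [←+1]-nf h ⟩
      A a (suc k) (B b) * m + B n   <⟨ +-monoʳ-< _ (mono n<n′ (nf-remainder<c h′)) ⟩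
      A a (suc k) (B b) * m + B n′  ≡⟨ [←+1]-nf h′ ⟨
      B d                           ∎
    where
    open ≤-Reasoning
    n<n′ : n < n′
    n<n′ = +-cancelˡ-< (A a k b * m) n n′ (subst₂ _<_ (NF.c≡ h) (NF.c≡ h′) c<d)

  B-<-step : StrictMonoBelow d → c < d → B c < B d
  -- 0 has no normal form, so B 0 computes to 0
  B-<-step {d} {zero} mono 0<d with a , b , _ , _ , h ← NF-exists 0<d =
    ≤-trans (positive (A′ᵈ a) (B b)) (B-lower h)
  B-<-step {d} {suc c} mono c<d with _ , _ , _ , _ , h ← NF-exists (s≤s z≤n)
                                 with _ , _ , _ , _ , h′ ← NF-exists (<-trans z<s c<d) =
    B-<-NF mono c<d h h′

  B-strictMonoBelow : ∀ D → StrictMonoBelow D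
  B-strictMonoBelow (suc D) x<y (s≤s y≤D) with m≤n⇒m<n∨m≡n y≤D
  ... | inj₁ y<D  = B-strictMonoBelow D x<y y<D
  ... | inj₂ refl = B-<-step (B-strictMonoBelow D) x<y

  base-change-NF : NF k c a b m n → NF (suc k) (B c) a (B b) m (B n)
  base-change-NF {a = a} h =
    mkNF ([←+1]-nf h) (≤-trans (mono-≤ (A′ᵈ a) z≤n) (B-lower h)) (B-level-upper mono h)
         (B-lower h) (B-upper mono h) (B-remainder< mono h)
    where
    mono : ∀ {D} → StrictMonoBelow D
    mono = B-strictMonoBelow _

mainTheorem7 : (k c a b m n : ℕ) → 2 ≤ k → IsNF k c a b m n →
    (c [ k ←+1] ≡ A a (suc k) (b [ k ←+1]) * m + n [ k ←+1]) ×
    IsNF (suc k) (c [ k ←+1]) a (b [ k ←+1]) m (n [ k ←+1])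
mainTheorem7 .(2 + k₀) c a b m n (s≤s (s≤s (z≤n {k₀}))) h = NF.c≡ h′ , NF⇒IsNF h′
  where
  h′ : NF (3 + k₀) (c [ 2 + k₀ ←+1]) a (b [ 2 + k₀ ←+1]) m (n [ 2 + k₀ ←+1])
  h′ = BaseChange.base-change-NF k₀ {c} {a} {b} {m} {n} (IsNF⇒NF h)
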